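{- There is an absolute constant $c>0$ such that for every sufficiently large $n\in\mathbb{N}$ there exists $p>0$ for which the number of non-degenerate triangles with vertices in $[n]\times[n]$ having perimeter $p$ is at least $c\,n^{5/2}$; i.e. there are $\Omega(n^{5/2})$ triangles with vertices in $[n]\times[n]$ having the same perimeter.
   Context: $[n]=\{1,2,\dots,n\}$. A triangle is non-degenerate if its vertices are not collinear; its perimeter is the sum of its Euclidean side lengths. -}

module Defs where

open import Data.Nat using (ℕ; zero; suc; _+_; _*_; _≤_; _≤?_; _≟_; ∣_-_∣)
open import Data.Product using (_×_; _,_)
open import Data.List using (List; []; _∷_; _++_; map; concatMap; upTo)
open import Relation.Nullary using (¬_; yes; no)

Point : Set
Point = ℕ × ℕ

-- The grid [n] × [n], as a duplicate-free list of points (coordinates 1..n).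
grid : ℕ → List Point
grid n = concatMap (λ i → map (λ j → (suc i , suc j)) (upTo n)) (upTo n)

Triangle : Set
Triangle = Point × Point × Point

-- Applied to the duplicate-free list 'grid n', each 3-element subset of
-- [n]×[n] occurs exactly once, so this enumerates unordered triples.
choose3 : {A : Set} → List A → List (A × A × A)
choose3 [] = []
choose3 (x ∷ xs) = pairsWith xs ++ choose3 xs
  where
  pairs : {A : Set} → List A → List (A × A)
  pairs [] = []
  pairs (y ∷ ys) = map (λ z → (y , z)) ys ++ pairs ys
  pairsWith : List _ → List _
  pairsWith ys = map (λ { (y , z) → (x , y , z) }) (pairs ys)

-- Collinearity: twice the signed area vanishes, written without subtraction.
Collinear : Triangle → Set
Collinear ((x₁ , y₁) , (x₂ , y₂) , (x₃ , y₃)) =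
  x₁ * y₂ + x₂ * y₃ + x₃ * y₁ ≡ x₁ * y₃ + x₂ * y₁ + x₃ * y₂
  where open import Relation.Binary.PropositionalEquality using (_≡_)

NonDegenerate : Triangle → Set
NonDegenerate t = ¬ Collinear t

triangles : ℕ → List Triangle
triangles n = choose3 (grid n)

sqDist : Point → Point → ℕ
sqDist (x₁ , y₁) (x₂ , y₂) = ∣ x₁ - x₂ ∣ * ∣ x₁ - x₂ ∣ + ∣ y₁ - y₂ ∣ * ∣ y₁ - y₂ ∣

-- Integer square root: ⌊√x⌋ = #{ k ∈ [1..x] : k*k ≤ x } (k*k ≤ x is monotone in k).
countSq : ℕ → ℕ → ℕ
countSq zero x = zero
countSq (suc k) x with suc k * suc k ≤? x
... | yes _ = suc (countSq k x)
... | no _ = countSq k x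

isqrt : ℕ → ℕ
isqrt x = countSq x x

-- Approximation of the (real) perimeter at scale m:
--   perApprox t m = Σ over the three sides of ⌊ m · |side| ⌋ = Σ ⌊√(m² · |side|²)⌋,
-- so that m·per(t) - 3 < perApprox t m ≤ m·per(t).
perApprox : Triangle → ℕ → ℕ
perApprox (a , b , c) m =
  isqrt (m * m * sqDist a b) + isqrt (m * m * sqDist b c) + isqrt (m * m * sqDist c a)

-- Equality of the real perimeters of two triangles (Bishop-style equality
-- of the constructive reals given by the approximations above):
-- per s = per t  iff  for every scale m, the approximations differ by at most 3.
SamePerimeter : Triangle → Triangle → Set
SamePerimeter s t = ∀ m → (perApprox s m ≤ perApprox t m + 3) × (perApprox t m ≤ perApprox s m + 3)

-- Euclid's parametrisation gives, for fixed T and every 0 < J < T, a Pythagorean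
-- triple with legs T² − J², 2TJ and hypotenuse T² + J².  Gluing two copies along
-- the leg 2TJ gives an isosceles lattice triangle with base 2(T² − J²), legs
-- T² + J² and perimeter 4T², independently of J.  With T ≈ √n / 2 these
-- triangles have base and height at most 2T² ≤ n / 2, so each of the T − 1
-- shapes can be translated to ≈ (n / 2)² positions inside [n] × [n]: this gives
-- ≈ √n · n² triangles of perimeter 4T².
module Submission where

open import Defs
open import Data.Empty using (⊥-elim)
open import Data.List using (List; []; _∷_; _++_; map; length; upTo; cartesianProduct)
open import Data.List.Membership.Propositional using (_∈_)
open import Data.List.Membership.Propositional.Properties
  using (∈-++⁺ˡ; ∈-++⁺ʳ; ∈-map⁺; ∈-concat⁺′; ∈-upTo⁺; ∈-upTo⁻; ∈-cartesianProduct⁺; ∈-cartesianProduct⁻)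
open import Data.List.Properties using (++-cancelʳ; map-++; length-++; length-map; length-upTo)
open import Data.List.Relation.Unary.All as All using (All; _∷_)
import Data.List.Relation.Unary.All.Properties as All
open import Data.List.Relation.Unary.AllPairs using (AllPairs; _∷_)
import Data.List.Relation.Unary.AllPairs.Properties as AllPairs
open import Data.List.Relation.Unary.Any using (here; there)
open import Data.List.Relation.Unary.Unique.Propositional using (Unique)
import Data.List.Relation.Unary.Unique.Propositional.Properties as Unique
open import Data.Nat
open import Data.Nat.Properties
open import Algebra.Properties.CommutativeSemigroup *-commutativeSemigroup using (interchange)
open import Data.Nat.Tactic.RingSolver using (solve-∀)
open import Data.Product using (Σ; ∃; _×_; _,_; proj₁; proj₂)
open import Function using (id; _∘_; _on_; case_of_)
open import Relation.Binary.PropositionalEquality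
open import Relation.Nullary using (yes; no)

square-≤-reflects : ∀ {m n} → m * m ≤ n * n → m ≤ n
square-≤-reflects m²≤n² = ≮⇒≥ λ n<m → <⇒≱ (*-mono-< n<m n<m) m²≤n²

countSq-square : ∀ s k → countSq k (s * s) ≡ k ⊓ s
countSq-square s zero = refl
countSq-square s (suc k) with suc k * suc k ≤? s * s
... | yes k+1²≤s² = begin
  suc (countSq k (s * s)) ≡⟨ cong suc (countSq-square s k) ⟩
  suc (k ⊓ s)             ≡⟨ cong suc (m≤n⇒m⊓n≡m (<⇒≤ k<s)) ⟩
  suc k                   ≡⟨ sym (m≤n⇒m⊓n≡m k<s) ⟩
  suc k ⊓ s               ∎
  where
  open ≡-Reasoning
  k<s = square-≤-reflects k+1²≤s²
... | no k+1²≰s² = begin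
  countSq k (s * s) ≡⟨ countSq-square s k ⟩
  k ⊓ s             ≡⟨ m≥n⇒m⊓n≡n s≤k ⟩
  s                 ≡⟨ sym (m≥n⇒m⊓n≡n (m≤n⇒m≤1+n s≤k)) ⟩
  suc k ⊓ s         ∎
  where
  open ≡-Reasoning
  s≤k = ≤-pred (≰⇒> λ k<s → k+1²≰s² (*-mono-≤ k<s k<s))

isqrt-square : ∀ s → isqrt (s * s) ≡ s
isqrt-square zero = refl
isqrt-square s@(suc _) = trans (countSq-square s (s * s)) (m≥n⇒m⊓n≡n (m≤m*n s s))

bracket : (f : ℕ → ℕ) → (∀ t → f t < f (suc t)) → ∀ {n} → f 0 ≤ n → ∃ λ t → f t ≤ n × n < f (suc t)
bracket f f-mono {zero} f0≤0 = 0 , f0≤0 , ≤-<-trans z≤n (f-mono 0)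
bracket f f-mono {suc n} f0≤n+1 with f 0 ≤? n
... | no f0≰n = 0 , f0≤n+1 , ≤-<-trans (≰⇒> f0≰n) (f-mono 0)
... | yes f0≤n with bracket f f-mono f0≤n
...   | t , ft≤n , n<ft+1 with f (suc t) ≤? suc n
...     | yes ft+1≤n+1 = suc t , ft+1≤n+1 , ≤-<-trans n<ft+1 (f-mono (suc t))
...     | no ft+1≰n+1 = t , m≤n⇒m≤1+n ft≤n , ≰⇒> ft+1≰n+1

length-cartesianProduct : {A B : Set} (xs : List A) (ys : List B) →
                          length (cartesianProduct xs ys) ≡ length xs * length ys
length-cartesianProduct [] ys = refl
length-cartesianProduct (x ∷ xs) ys = begin
  length (map (x ,_) ys ++ cartesianProduct xs ys)     ≡⟨ length-++ (map (x ,_) ys) ⟩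
  length (map (x ,_) ys) + length (cartesianProduct xs ys)
    ≡⟨ cong₂ _+_ (length-map (x ,_) ys) (length-cartesianProduct xs ys) ⟩
  length ys + length xs * length ys                    ∎
  where open ≡-Reasoning

pairs : {A : Set} → List A → List (A × A)
pairs [] = []
pairs (y ∷ ys) = map (y ,_) ys ++ pairs ys

-- The pair enumeration used by choose3 is local to it, so it is only
-- related to pairs through the map (x ,_) that choose3 applies to it.
choose3-∷ : {A : Set} (x : A) (xs : List A) → choose3 (x ∷ xs) ≡ map (x ,_) (pairs xs) ++ choose3 xs
choose3-∷ x [] = refl
choose3-∷ x (y ∷ ys) = cong (_++ choose3 (y ∷ ys)) (begin
  _                                                   ≡⟨ map-++ (x ,_) (map (y ,_) ys) _ ⟩
  map (x ,_) (map (y ,_) ys) ++ _                     ≡⟨ cong (map (x ,_) (map (y ,_) ys) ++_) tails≡ ⟩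
  map (x ,_) (map (y ,_) ys) ++ map (x ,_) (pairs ys) ≡⟨ map-++ (x ,_) (map (y ,_) ys) (pairs ys) ⟨
  map (x ,_) (pairs (y ∷ ys))                         ∎)
  where
  open ≡-Reasoning
  tails≡ = ++-cancelʳ (choose3 ys) _ _ (choose3-∷ x ys)

module SortedBy {A : Set} (key : A → ℕ) where

  Sorted : List A → Set
  Sorted = AllPairs (_≤_ on key)

  ∈-tail : ∀ {x xs a b} → All (λ y → key x ≤ key y) xs → a ∈ x ∷ xs → key a < key b → b ∈ x ∷ xs → b ∈ xs
  ∈-tail _ _ _ (there b∈xs) = b∈xs
  ∈-tail _ (here refl) a<b (here refl) = ⊥-elim (<-irrefl refl a<b)
  ∈-tail x≤xs (there a∈xs) a<b (here refl) = ⊥-elim (<⇒≱ a<b (All.lookup x≤xs a∈xs))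

  ∈-pairs⁺ : ∀ {xs a b} → Sorted xs → a ∈ xs → b ∈ xs → key a < key b → (a , b) ∈ pairs xs
  ∈-pairs⁺ {x ∷ xs} (x≤xs ∷ _) a∈@(here refl) b∈ a<b =
    ∈-++⁺ˡ (∈-map⁺ (x ,_) (∈-tail x≤xs a∈ a<b b∈))
  ∈-pairs⁺ {x ∷ xs} (x≤xs ∷ sorted) a∈@(there a∈xs) b∈ a<b =
    ∈-++⁺ʳ (map (x ,_) xs) (∈-pairs⁺ sorted a∈xs (∈-tail x≤xs a∈ a<b b∈) a<b)

  ∈-choose3⁺ : ∀ {xs a b c} → Sorted xs → a ∈ xs → b ∈ xs → c ∈ xs →
               key a < key b → key b < key c → (a , b , c) ∈ choose3 xs
  ∈-choose3⁺ {x ∷ xs} (x≤xs ∷ sorted) a∈ b∈ c∈ a<b b<c rewrite choose3-∷ x xs =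
    case a∈ of λ where
      (here refl) → ∈-++⁺ˡ (∈-map⁺ (x ,_) (∈-pairs⁺ sorted b∈xs c∈xs b<c))
      (there a∈xs) → ∈-++⁺ʳ (map (x ,_) (pairs xs)) (∈-choose3⁺ sorted a∈xs b∈xs c∈xs a<b b<c)
    where
    b∈xs = ∈-tail x≤xs a∈ a<b b∈
    c∈xs = ∈-tail x≤xs a∈ (<-trans a<b b<c) c∈

open SortedBy {Point} proj₁ using (Sorted; ∈-choose3⁺)

grid-sorted : ∀ n → Sorted (grid n)
grid-sorted n = AllPairs.concat⁺ (All.map⁺ (All.applyUpTo⁺₂ id n λ _ → rowSorted)) rowsIncreasing
  where
  rowSorted : ∀ {i} → Sorted (map (λ j → (suc i , suc j)) (upTo n))
  rowSorted = AllPairs.map⁺ (AllPairs.applyUpTo⁺₂ id n λ _ _ → ≤-refl)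
  rowsIncreasing = AllPairs.map⁺ (AllPairs.applyUpTo⁺₁ id n λ i<i′ _ →
    All.map⁺ (All.applyUpTo⁺₂ id n λ _ → All.map⁺ (All.applyUpTo⁺₂ id n λ _ → <⇒≤ (s≤s i<i′))))

∈-grid : ∀ {n i j} → i < n → j < n → (suc i , suc j) ∈ grid n
∈-grid {n} {i} i<n j<n =
  ∈-concat⁺′ (∈-map⁺ (λ j → (suc i , suc j)) (∈-upTo⁺ j<n))
             (∈-map⁺ (λ i → map (λ j → (suc i , suc j)) (upTo n)) (∈-upTo⁺ i<n))

isosceles : Point → ℕ → ℕ → Triangle
isosceles (a , b) x h = (a , b) , (a + x , b + h) , (a + x + x , b)

module _ (a b x h : ℕ) where

  sqDist-isosceles-left : sqDist (a , b) (a + x , b + h) ≡ x * x + h * h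
  sqDist-isosceles-left rewrite ∣m-m+n∣≡n a x | ∣m-m+n∣≡n b h = refl

  sqDist-isosceles-right : sqDist (a + x , b + h) (a + x + x , b) ≡ x * x + h * h
  sqDist-isosceles-right rewrite ∣m-m+n∣≡n (a + x) x | ∣-∣-comm (b + h) b | ∣m-m+n∣≡n b h = refl

  sqDist-isosceles-base : sqDist (a + x + x , b) (a , b) ≡ (x + x) * (x + x)
  sqDist-isosceles-base
    rewrite +-assoc a x x | ∣-∣-comm (a + (x + x)) a | ∣m-m+n∣≡n a (x + x) | ∣n-n∣≡0 b =
    +-identityʳ _

isqrt-scaled-square : ∀ m {d r} → d ≡ r * r → isqrt (m * m * d) ≡ m * r
isqrt-scaled-square m {r = r} refl = trans (cong isqrt (interchange m m r r)) (isqrt-square (m * r))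

perApprox-isosceles : ∀ p {x h r} → x * x + h * h ≡ r * r →
                      ∀ m → perApprox (isosceles p x h) m ≡ m * r + m * r + m * (x + x)
perApprox-isosceles (a , b) {x} {h} pythagoras m = cong₂ _+_
  (cong₂ _+_ (isqrt-scaled-square m (trans (sqDist-isosceles-left a b x h) pythagoras))
             (isqrt-scaled-square m (trans (sqDist-isosceles-right a b x h) pythagoras)))
  (isqrt-scaled-square m (sqDist-isosceles-base a b x h))

-- The two sides of the collinearity equation differ by twice the area, 2xh.
isosceles-nonDegenerate : ∀ p {x h} → 0 < x → 0 < h → NonDegenerate (isosceles p x h)
isosceles-nonDegenerate (a , b) {x} {h} 0<x 0<h collinear =
  <⇒≢ (*-mono-< (*-mono-< {0} {2} z<s 0<x) 0<h) (sym (+-cancelˡ-≡ lhs (2 * x * h) 0 (begin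
    lhs + 2 * x * h                             ≡⟨ twiceArea a b x h ⟩
    a * b + (a + x) * b + (a + x + x) * (b + h) ≡⟨ collinear ⟨
    lhs                                         ≡⟨ +-identityʳ lhs ⟨
    lhs + 0                                     ∎)))
  where
  open ≡-Reasoning
  lhs = a * (b + h) + (a + x) * b + (a + x + x) * b
  twiceArea : ∀ a b x h →
    a * (b + h) + (a + x) * b + (a + x + x) * b + 2 * x * h ≡ a * b + (a + x) * b + (a + x + x) * (b + h)
  twiceArea = solve-∀

isosceles-∈-triangles : ∀ {n u v x h} → 0 < x → u + (x + x) < n → v + h < n →
                        isosceles (suc u , suc v) x h ∈ triangles n
isosceles-∈-triangles {n} {u} {v} {x} {h} 0<x base<n height<n =
  ∈-choose3⁺ (grid-sorted n) (∈-grid u<n v<n) (∈-grid u+x<n height<n) (∈-grid u+x+x<n v<n)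
             (m<m+n (suc u) 0<x) (m<m+n (suc u + x) 0<x)
  where
  u+x+x<n = subst (_< n) (sym (+-assoc u x x)) base<n
  u+x<n = ≤-<-trans (m≤m+n (u + x) x) u+x+x<n
  u<n = ≤-<-trans (m≤m+n u x) u+x<n
  v<n = ≤-<-trans (m≤m+n v h) height<n

-- euclidLeg J K = T² − J² for T = J + K; with 2TJ and T² + J² it forms Euclid's triple.
euclidLeg : ℕ → ℕ → ℕ
euclidLeg J K = K * (K + 2 * J)

module Euclid {J K T : ℕ} (J+K≡T : J + K ≡ T) where

  leg : ℕ
  leg = euclidLeg J K

  hypotenuse : ℕ
  hypotenuse = T * T + J * J

  pythagoras : leg * leg + 2 * T * J * (2 * T * J) ≡ hypotenuse * hypotenuse
  pythagoras = subst (λ T → leg * leg + 2 * T * J * (2 * T * J) ≡ (T * T + J * J) * (T * T + J * J))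
                     J+K≡T (identity J K)
    where
    identity : ∀ J K → let T = J + K; leg = K * (K + 2 * J) in
      leg * leg + 2 * T * J * (2 * T * J) ≡ (T * T + J * J) * (T * T + J * J)
    identity = solve-∀

  perimeter : ∀ m → m * hypotenuse + m * hypotenuse + m * (leg + leg) ≡ m * (4 * T * T)
  perimeter m = subst (λ T → m * (T * T + J * J) + m * (T * T + J * J) + m * (leg + leg) ≡ m * (4 * T * T))
                      J+K≡T (identity J K m)
    where
    identity : ∀ J K m → let T = J + K; leg = K * (K + 2 * J) in
      m * (T * T + J * J) + m * (T * T + J * J) + m * (leg + leg) ≡ m * (4 * T * T)
    identity = solve-∀

  leg+leg≤2T² : leg + leg ≤ 2 * T * T
  leg+leg≤2T² = subst (λ T → leg + leg ≤ 2 * T * T) J+K≡T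
                   (subst (leg + leg ≤_) (identity J K) (m≤m+n (leg + leg) (2 * J * J)))
    where
    identity : ∀ J K → let leg = K * (K + 2 * J) in leg + leg + 2 * J * J ≡ 2 * (J + K) * (J + K)
    identity = solve-∀

euclidTriangle : ℕ → ℕ → Point → Triangle
euclidTriangle T J p = isosceles p (euclidLeg J (T ∸ J)) (2 * T * J)

module _ {J T : ℕ} (J<T : J < T) where
  open Euclid {J} {T ∸ J} (m+[n∸m]≡n (<⇒≤ J<T))

  euclidTriangle-perApprox : ∀ p m → perApprox (euclidTriangle T J p) m ≡ m * (4 * T * T)
  euclidTriangle-perApprox p m = trans (perApprox-isosceles p pythagoras m) (perimeter m)

  0<leg : 0 < leg
  0<leg = *-mono-< 0<T-J (≤-trans 0<T-J (m≤m+n (T ∸ J) (2 * J)))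
    where 0<T-J = m<n⇒0<n∸m J<T

  euclidTriangle-nonDegenerate : 0 < J → ∀ p → NonDegenerate (euclidTriangle T J p)
  euclidTriangle-nonDegenerate 0<J p =
    isosceles-nonDegenerate p 0<leg (*-mono-< (*-mono-< {0} {2} z<s (<-trans 0<J J<T)) 0<J)

  euclidTriangle-∈-triangles : ∀ {n u v} → u + 2 * T * T < n → v + 2 * T * T < n →
                               euclidTriangle T J (suc u , suc v) ∈ triangles n
  euclidTriangle-∈-triangles {u = u} {v} u+2T²<n v+2T²<n = isosceles-∈-triangles 0<leg
    (≤-<-trans (+-monoʳ-≤ u leg+leg≤2T²) u+2T²<n)
    (≤-<-trans (+-monoʳ-≤ v (*-monoʳ-≤ (2 * T) (<⇒≤ J<T))) v+2T²<n)

EqualPerimeterFamily : ℕ → ℕ → Set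
EqualPerimeterFamily n ℓ =
  Σ Triangle λ t → (t ∈ triangles n) × NonDegenerate t ×
  Σ (List Triangle) λ L →
    Unique L × All (λ s → (s ∈ triangles n) × NonDegenerate s × SamePerimeter s t) L × length L ≡ ℓ

samePerimeter : ∀ {s t} → (∀ m → perApprox s m ≡ perApprox t m) → SamePerimeter s t
samePerimeter s≡t m = ≤-trans (≤-reflexive (s≡t m)) (m≤m+n _ 3) ,
                       ≤-trans (≤-reflexive (sym (s≡t m))) (m≤m+n _ 3)

module Translates (k W : ℕ) where

  T : ℕ
  T = suc k

  Index : Set
  Index = ℕ × ℕ × ℕ

  indices : List Index
  indices = cartesianProduct (upTo k) (cartesianProduct (upTo W) (upTo W))

  member : Index → Triangle
  member (j , u , v) = euclidTriangle T (suc j) (suc u , suc v)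

  members : List Triangle
  members = map member indices

  member-injective : ∀ {p q} → member p ≡ member q → p ≡ q
  member-injective {j , u , v} {j′ , u′ , v′} eq = cong₂ _,_ j≡j′ (cong₂ _,_ u≡u′ v≡v′)
    where
    u≡u′ = suc-injective (cong (proj₁ ∘ proj₁) eq)
    v≡v′ = suc-injective (cong (proj₂ ∘ proj₁) eq)
    apexHeight : suc v + 2 * T * suc j ≡ suc v + 2 * T * suc j′
    apexHeight = trans (cong (proj₂ ∘ proj₁ ∘ proj₂) eq) (cong (λ v → suc v + 2 * T * suc j′) (sym v≡v′))
    j≡j′ = suc-injective (*-cancelˡ-≡ (suc j) (suc j′) (2 * T) (+-cancelˡ-≡ (suc v) _ _ apexHeight))

  unique-members : Unique members
  unique-members = Unique.map⁺ member-injective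
    (Unique.cartesianProduct⁺ (Unique.upTo⁺ k) (Unique.cartesianProduct⁺ (Unique.upTo⁺ W) (Unique.upTo⁺ W)))

  length-members : length members ≡ k * (W * W)
  length-members = begin
    length members                         ≡⟨ length-map member indices ⟩
    length indices                         ≡⟨ length-cartesianProduct (upTo k) _ ⟩
    length (upTo k) * length (cartesianProduct (upTo W) (upTo W))
      ≡⟨ cong₂ _*_ (length-upTo k) (length-cartesianProduct (upTo W) (upTo W)) ⟩
    k * (length (upTo W) * length (upTo W)) ≡⟨ cong (λ w → k * (w * w)) (length-upTo W) ⟩
    k * (W * W)                            ∎
    where open ≡-Reasoning

  module _ {n : ℕ} (W+2T²≤n : W + 2 * T * T ≤ n) where

    Good : Triangle → Set
    Good s = (s ∈ triangles n) × NonDegenerate s × (∀ m → perApprox s m ≡ m * (4 * T * T))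

    member-good : ∀ {p} → p ∈ indices → Good (member p)
    member-good {j , u , v} p∈ =
      euclidTriangle-∈-triangles J<T (inBox u<W) (inBox v<W) ,
      euclidTriangle-nonDegenerate J<T z<s (suc u , suc v) ,
      euclidTriangle-perApprox J<T (suc u , suc v)
      where
      j∈ = proj₁ (∈-cartesianProduct⁻ (upTo k) _ p∈)
      uv∈ = proj₂ (∈-cartesianProduct⁻ (upTo k) _ p∈)
      J<T = s≤s (∈-upTo⁻ j∈)
      u<W = ∈-upTo⁻ (proj₁ (∈-cartesianProduct⁻ (upTo W) (upTo W) uv∈))
      v<W = ∈-upTo⁻ (proj₂ (∈-cartesianProduct⁻ (upTo W) (upTo W) uv∈))
      inBox : ∀ {w} → w < W → w + 2 * T * T < n
      inBox w<W = <-≤-trans (+-monoˡ-< (2 * T * T) w<W) W+2T²≤n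

    equalPerimeterFamily : 0 < k → 0 < W → EqualPerimeterFamily n (k * (W * W))
    equalPerimeterFamily 0<k 0<W =
      member origin , proj₁ origin-good , proj₁ (proj₂ origin-good) ,
      members , unique-members ,
      All.map⁺ (All.tabulate λ {p} p∈ → let (s∈ , s-nd , s-per) = member-good p∈ in
        s∈ , s-nd , samePerimeter {member p} {member origin} λ m → trans (s-per m) (sym (origin-per m))) ,
      length-members
      where
      origin : Index
      origin = 0 , 0 , 0
      origin-good : Good (member origin)
      origin-good = member-good (∈-cartesianProduct⁺ (∈-upTo⁺ 0<k)
                                   (∈-cartesianProduct⁺ (∈-upTo⁺ 0<W) (∈-upTo⁺ 0<W)))
      origin-per = proj₂ (proj₂ origin-good)

-- T = k + 1 is chosen with (2T)² ≤ n < (2T + 2)², and W = n ∸ 2T² is the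
-- room left for translations once the triangle's bounding box is removed.
chooseScale : ∀ {n} → 36 ≤ n → Σ ℕ λ k → Σ ℕ λ W →
              (0 < k) × (0 < W) × (W + 2 * suc k * suc k ≤ n) × (n ≤ W + W) × (n ≤ 4 * k * (4 * k))
chooseScale {n} 36≤n = suc (suc i) , W , z<s , <-≤-trans z<s D≤W , ≤-reflexive W+D≡n , n≤W+W , n≤16k²
  where
  side : ℕ → ℕ
  side i = 3 + i + (3 + i)
  side-mono : ∀ i → side i * side i < side (suc i) * side (suc i)
  side-mono i = *-mono-< lt lt
    where lt = +-mono-< (n<1+n (3 + i)) (n<1+n (3 + i))
  bracketing = bracket (λ i → side i * side i) side-mono 36≤n
  i = proj₁ bracketing
  T = 3 + i
  D = 2 * T * T
  W = n ∸ D
  D+D≤n : D + D ≤ n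
  D+D≤n = subst (_≤ n) (identity i) (proj₁ (proj₂ bracketing))
    where
    identity : ∀ i → (3 + i + (3 + i)) * (3 + i + (3 + i)) ≡ 2 * (3 + i) * (3 + i) + 2 * (3 + i) * (3 + i)
    identity = solve-∀
  W+D≡n : W + D ≡ n
  W+D≡n = m∸n+n≡m (≤-trans (m≤m+n D D) D+D≤n)
  D≤W : D ≤ W
  D≤W = +-cancelʳ-≤ D D W (subst (D + D ≤_) (sym W+D≡n) D+D≤n)
  n≤W+W : n ≤ W + W
  n≤W+W = subst (_≤ W + W) W+D≡n (+-monoʳ-≤ W D≤W)
  n≤16k² : n ≤ 4 * (2 + i) * (4 * (2 + i))
  n≤16k² = ≤-trans (<⇒≤ (proj₂ (proj₂ bracketing))) (*-mono-≤ side≤ side≤)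
    where
    identity : ∀ i → 4 + i + (4 + i) + (i + i) ≡ 4 * (2 + i)
    identity = solve-∀
    side≤ = subst (side (suc i) ≤_) (identity i) (m≤m+n (side (suc i)) (i + i))

fifthPower-bound : ∀ {n k W} → n ≤ W + W → n ≤ 4 * k * (4 * k) →
                   1 * 1 * n ^ 5 ≤ (16 * (k * (W * W))) * (16 * (k * (W * W)))
fifthPower-bound {n} {k} {W} n≤2W n≤16k² = begin
  1 * 1 * n ^ 5                                     ≡⟨ split n ⟩
  n * ((n * n) * (n * n))                           ≤⟨ *-mono-≤ n≤16k² (*-mono-≤ n²≤ n²≤) ⟩
  4 * k * (4 * k) * (((W + W) * (W + W)) * ((W + W) * (W + W))) ≡⟨ regroup k W ⟩
  (16 * (k * (W * W))) * (16 * (k * (W * W)))       ∎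
  where
  open ≤-Reasoning
  n²≤ = *-mono-≤ n≤2W n≤2W
  split : ∀ n → 1 * (n * (n * (n * (n * (n * 1))))) ≡ n * ((n * n) * (n * n))
  split = solve-∀
  regroup : ∀ k W → 4 * k * (4 * k) * (((W + W) * (W + W)) * ((W + W) * (W + W)))
                    ≡ (16 * (k * (W * W))) * (16 * (k * (W * W)))
  regroup = solve-∀

proposition2 : Σ ℕ λ a → Σ ℕ λ b → (0 < a) × (0 < b) × Σ ℕ λ N₀ → ∀ n → N₀ ≤ n →
    Σ Triangle λ t → (t ∈ triangles n) × NonDegenerate t ×
    Σ (List Triangle) λ L →
    Unique L × All (λ s → (s ∈ triangles n) × NonDegenerate s × SamePerimeter s t) L ×
    (a * a * n ^ 5 ≤ (b * length L) * (b * length L))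
proposition2 = 1 , 16 , z<s , z<s , 36 , λ n 36≤n →
  let k , W , 0<k , 0<W , box≤n , n≤2W , n≤16k² = chooseScale 36≤n
      t , t∈ , t-nd , L , unique , good , |L|≡ = Translates.equalPerimeterFamily k W box≤n 0<k 0<W
  in t , t∈ , t-nd , L , unique , good ,
     subst (λ ℓ → 1 * 1 * n ^ 5 ≤ (16 * ℓ) * (16 * ℓ)) (sym |L|≡)
           (fifthPower-bound {k = k} {W = W} n≤2W n≤16k²)
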